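{- Let $G=(V,E)$ be a DAG and $\rho>1$ an integer. Define $V_1=\{v\in V:|A_G(v)|\le\rho\}$ and, for $i>1$, $V_i=\{v\in V\setminus\bigcup_{j<i}V_j : |A_G(v)\setminus\bigcup_{j<i}V_j|\le\rho\}$, and let $L$ be the maximum index with $V_L$ nonempty. With high probability, ScheduleGeneralGraph$(G)$ calls ScheduleSmallSubgraph at most $L$ times.
   Context: For a DAG $G$ and vertex $v$, $A_G(v)$ is the set of vertices $u$ with a directed path from $u$ to $v$ in $G$, together with $v$. Estimates $\hat a(v)$ of ancestor-set sizes are computed with mergeable count-distinct sketches, satisfying $\frac23|A(v)|\le\hat a(v)\le\frac43|A(v)|$ w.h.p. "With high probability": probability at least $1-n^{ -c}$ for any constant $c\ge1$, $n=|V|$. ScheduleGeneralGraph$(G)$: while $G$ is nonempty: set $V_H=\emptyset$; initialize a queue with the sources of the current $G$; repeatedly dequeue $v$, compute the estimate $\hat a(v)$ of the size of its ancestor set in the current graph, and if $\hat a(v)\le\frac43\rho$, mark $v$, add it to $V_H$, and enqueue every successor of $v$ all of whose predecessors are marked; when the queue is empty, let $H$ be the subgraph induced by $V_H$, append it to the list of small subgraphs, and remove $V_H$ and incident edges from $G$. Afterwards, ScheduleSmallSubgraph is called once on each small subgraph in the list, in order. -}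

module Defs where

open import Data.Bool using (Bool; true; false; not; _∧_; _∨_; if_then_else_)
open import Data.Nat using (ℕ; zero; suc; _+_; _*_; _≤_; _<_; _≤ᵇ_; _≡ᵇ_)
open import Data.Fin using (Fin)
open import Data.Fin.Subset using (Subset; _∈_; _∉_; ⊥; ⊤; _∪_; _─_; ∣_∣; ⁅_⁆)
open import Data.Vec using (lookup; tabulate)
open import Data.List using (List; []; _∷_; _++_; filter; allFin; foldr)
open import Data.Maybe using (Maybe; just; nothing)
open import Data.Product using (_×_)
open import Data.Sum using (_⊎_)
open import Data.Integer using (+_)
open import Data.Rational using (ℚ; _/_) renaming (_≤_ to _≤ℚ_; _≤ᵇ_ to _≤ℚᵇ_)
open import Relation.Binary.PropositionalEquality using (_≡_)
open import Relation.Nullary using (¬_)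
open import Relation.Nullary.Decidable using (T?)
open import Function.Bundles using (_⇔_)

Graph : ℕ → Set
Graph n = Fin n → Fin n → Bool

-- Directed paths (of length ≥ 1) from u to v in the subgraph of E
-- induced by the vertex set R.
data Path {n : ℕ} (E : Graph n) (R : Subset n) : Fin n → Fin n → Set where
  edge : ∀ {u v} → u ∈ R → v ∈ R → E u v ≡ true → Path E R u v
  step : ∀ {u w v} → Path E R u w → E w v ≡ true → v ∈ R → Path E R u v

Acyclic : {n : ℕ} → Graph n → Set
Acyclic E = ∀ v → ¬ Path E ⊤ v v

IsAncestorSet : {n : ℕ} → Graph n → Subset n → Fin n → Subset n → Set
IsAncestorSet E R v S = ∀ u → (u ∈ S) ⇔ (u ≡ v ⊎ Path E R u v)

fourThirds : ℕ → ℚ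
fourThirds k = (+ (4 * k)) / 3

twoThirds : ℕ → ℚ
twoThirds k = (+ (2 * k)) / 3

-- A (possibly adversarial) estimator satisfies the w.h.p. guarantee:
-- for every round k, current vertex set R, and vertex v of R,
-- (2/3)|A(v)| ≤ â(v) ≤ (4/3)|A(v)| where A(v) is the ancestor set in G[R].
GoodEstimator : {n : ℕ} → Graph n → (ℕ → Subset n → Fin n → ℚ) → Set
GoodEstimator E est =
  ∀ k R v S → v ∈ R → IsAncestorSet E R v S →
    (twoThirds ∣ S ∣ ≤ℚ est k R v) × (est k R v ≤ℚ fourThirds ∣ S ∣)

nextLayer : {n : ℕ} → (Fin n → Subset n) → ℕ → Subset n → Subset n
nextLayer anc ρ U = tabulate (λ v → not (lookup U v) ∧ (∣ anc v ─ U ∣ ≤ᵇ ρ))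

unionUpTo : {n : ℕ} → (Fin n → Subset n) → ℕ → ℕ → Subset n
unionUpTo anc ρ zero = ⊥
unionUpTo anc ρ (suc i) = unionUpTo anc ρ i ∪ nextLayer anc ρ (unionUpTo anc ρ i)

-- layer anc ρ i = V_i  (for i ≥ 1;  layer 0 is unused)
layer : {n : ℕ} → (Fin n → Subset n) → ℕ → ℕ → Subset n
layer anc ρ zero = ⊥
layer anc ρ (suc i) = nextLayer anc ρ (unionUpTo anc ρ i)

-- ScheduleGeneralGraph, with explicit fuel; running out of fuel yields
-- 'nothing' (so the fuel can never make the statement easier).

allB : {A : Set} → (A → Bool) → List A → Bool
allB p = foldr (λ x b → p x ∧ b) true

module Algorithm {n : ℕ} (E : Graph n) (ρ : ℕ) (est : ℕ → Subset n → Fin n → ℚ) where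

  sources : Subset n → List (Fin n)
  sources R = filter (λ v → T? (lookup R v ∧ allB (λ u → not (lookup R u ∧ E u v)) (allFin n))) (allFin n)

  readySuccs : Subset n → Subset n → Fin n → List (Fin n)
  readySuccs R M v = filter (λ w → T? (lookup R w ∧ E v w ∧ allB (λ u → not (lookup R u ∧ E u w) ∨ lookup M u) (allFin n))) (allFin n)

  queueLoop : ℕ → Subset n → ℕ → List (Fin n) → Subset n → Maybe (Subset n)
  queueLoop k R _ [] M = just M
  queueLoop k R zero (_ ∷ _) M = nothing
  queueLoop k R (suc f) (v ∷ q) M =
    if est k R v ≤ℚᵇ fourThirds ρ
    then queueLoop k R f (q ++ readySuccs R (M ∪ ⁅ v ⁆) v) (M ∪ ⁅ v ⁆)
    else queueLoop k R f q M

  rounds : ℕ → ℕ → Subset n → Maybe (List (Subset n))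
  rounds f k R with ∣ R ∣ ≡ᵇ 0
  ... | true = just []
  rounds zero k R | false = nothing
  rounds (suc f) k R | false with queueLoop k R (suc n * suc n) (sources R) ⊥
  ... | nothing = nothing
  ... | just H with rounds f (suc k) (R ─ H)
  ...   | nothing = nothing
  ...   | just Hs = just (H ∷ Hs)

  -- ScheduleGeneralGraph(G): the list of small subgraphs on which
  -- ScheduleSmallSubgraph is subsequently called (once each).
  scheduleGeneralGraph : Maybe (List (Subset n))
  scheduleGeneralGraph = rounds (suc n) zero ⊤

-- In round k the queue marks every vertex whose ancestor set in the current
-- graph has at most ρ elements: such a vertex is accepted (its estimate is at
-- most 4ρ/3), all its ancestors are such vertices as well, and a vertex is
-- enqueued as soon as its last predecessor is marked.  Hence, if the graph
-- left after k rounds avoids V_1 ∪ … ∪ V_k, then every vertex of V_{k+1} it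
-- contains has at most |A_G(v) ∖ (V_1 ∪ … ∪ V_k)| ≤ ρ current ancestors and is
-- removed in round k+1.  Since every vertex lies in some V_i with i ≤ L
-- (a vertex outside V_1 ∪ … ∪ V_L that is minimal there would belong to
-- V_{L+1}), the graph is empty after at most L rounds.  A source of the current
-- graph is always marked, so each round makes progress and the fuel suffices.
module Submission where

open import Defs
open import Data.Nat using (ℕ; _≤_; _<_)
open import Data.Fin using (Fin)
open import Data.Fin.Subset using (Subset; Nonempty; Empty; ⊤)
open import Data.List using (List; length)
open import Data.Maybe using (just)
open import Data.Product using (_×_; ∃-syntax)
open import Data.Rational using (ℚ)
open import Relation.Binary.PropositionalEquality using (_≡_)

open import Data.Bool using (Bool; true; false; not; _∧_; _∨_; T)
open import Data.Bool.Properties using (T-≡; T-∧; T-not-≡)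
open import Data.Empty using (⊥-elim)
open import Data.Fin using (_≟_)
open import Data.Fin.Properties using (any?)
open import Data.Fin.Subset using (_∈_; _∉_; _⊆_; _∪_; _─_; ∣_∣; ⁅_⁆; ∁)
  renaming (⊥ to ∅)
open import Data.Fin.Subset.Properties
  using (∉⊥; ∈⊤; x∈⁅x⁆; x∈⁅y⁆⇒x≡y; ∣⁅x⁆∣≡1; p⊆q⇒∣p∣≤∣q∣; p⊂q⇒∣p∣<∣q∣; ∣p∣≤n; ∣⊤∣≡n; ∣⊥∣≡0;
         p⊆p∪q; q⊆p∪q; x∈p∪q⁻; p─⊥≡p; p─q⊆p; p─q─r≡p─q∪r; x∈p∧x∉q⇒x∈p─q;
         x∈p⇒∣p-x∣<∣p∣; x∈∁p⇒x∉p; x∉p⇒x∈∁p; Empty-unique; nonempty?; _∈?_)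
open import Data.Integer using (ℤ; +_; +≤+) renaming (_≤_ to _≤ℤ_)
import Data.Integer.Properties as ℤ
open import Data.List using ([]; _∷_; _++_; allFin)
open import Data.List.Membership.Propositional using () renaming (_∈_ to _∈ₗ_)
open import Data.List.Membership.Propositional.Properties
  using (∈-++⁺ˡ; ∈-++⁺ʳ; ∈-++⁻; ∈-filter⁺; ∈-filter⁻; ∈-allFin)
open import Data.List.Relation.Unary.Any using (here; there)
import Data.List.Relation.Unary.AllPairs as AllPairs
import Data.List.Relation.Unary.All as All
open import Data.List.Relation.Unary.Unique.Propositional using (Unique)
open import Data.List.Relation.Unary.Unique.Propositional.Properties using (++⁺; filter⁺; allFin⁺)
open import Data.Nat using (zero; suc; _*_; _+_; _≡ᵇ_; z≤n; s≤s; NonZero)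
open import Data.Nat.Induction using (<-wellFounded)
open import Data.Nat.Properties
  using (≤-refl; ≤-trans; <-≤-trans; <⇒≤; ≤-pred; n≮0; ≤∧≢⇒<; ≤-reflexive; +-suc; +-identityʳ;
         ≤ᵇ⇒≤; ≤⇒≤ᵇ; ≡⇒≡ᵇ; *-monoʳ-≤; m≤m*n; n≤1+n)
open import Data.Product using (_,_; proj₁; proj₂)
open import Data.Rational using (_/_) renaming (_≤_ to _≤ℚ_; _≤ᵇ_ to _≤ℚᵇ_)
open import Data.Rational.Properties using (toℚᵘ-cancel-≤; toℚᵘ-fromℚᵘ)
  renaming (≤-trans to ≤ℚ-trans; ≤⇒≤ᵇ to ≤ℚ⇒≤ℚᵇ)
open import Data.Rational.Unnormalised using (mkℚᵘ; *≤*)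
open import Data.Rational.Unnormalised.Properties using (≤-respˡ-≃; ≤-respʳ-≃; ≃-sym)
open import Data.Sum using (_⊎_; inj₁; inj₂; [_,_])
open import Data.Vec using (_∷_; here; there; lookup)
open import Data.Vec.Properties using ([]=⇒lookup; lookup⇒[]=; lookup∘tabulate)
open import Function using (_∘_; id)
open import Function.Bundles using (Equivalence)
open import Induction.WellFounded using (WellFounded; Acc; acc; module Subrelation)
open import Relation.Binary.Construct.On as On using ()
open import Relation.Binary.PropositionalEquality using (refl; sym; trans; cong; subst)
open import Relation.Nullary using (¬_; yes; no; contradiction; ¬?)
open import Relation.Nullary.Decidable using (_×-dec_; decidable-stable)

open Equivalence using (to; from)

allB⁻ : ∀ {A : Set} (p : A → Bool) xs → T (allB p xs) → ∀ {x} → x ∈ₗ xs → T (p x)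
allB⁻ p (y ∷ ys) t (here refl) = proj₁ (T-∧ .to t)
allB⁻ p (y ∷ ys) t (there x∈ys) = allB⁻ p ys (proj₂ (T-∧ .to t)) x∈ys

allB⁺ : ∀ {A : Set} (p : A → Bool) xs → (∀ {x} → x ∈ₗ xs → T (p x)) → T (allB p xs)
allB⁺ p [] _ = _
allB⁺ p (y ∷ ys) h = T-∧ .from (h (here refl) , allB⁺ p ys (h ∘ there))

not-∧⁻ : ∀ {a b} → T (not (a ∧ b)) → a ≡ true → ¬ b ≡ true
not-∧⁻ () refl refl

not-∧⁺ : ∀ {a b} → (a ≡ true → ¬ b ≡ true) → T (not (a ∧ b))
not-∧⁺ {false} _ = _
not-∧⁺ {true} {false} _ = _
not-∧⁺ {true} {true} h = h refl refl

not-∧-∨⁻ : ∀ {a b c} → T (not (a ∧ b) ∨ c) → a ≡ true → b ≡ true → c ≡ true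
not-∧-∨⁻ {c = true} _ _ _ = refl
not-∧-∨⁻ {true} {true} {false} () refl refl

not-∧-∨⁺ : ∀ {a b c} → (a ≡ true → b ≡ true → c ≡ true) → T (not (a ∧ b) ∨ c)
not-∧-∨⁺ {false} _ = _
not-∧-∨⁺ {true} {false} _ = _
not-∧-∨⁺ {true} {true} h with refl ← h refl refl = _

∉⇒lookup≡false : ∀ {n} {x : Fin n} {p : Subset n} → x ∉ p → lookup p x ≡ false
∉⇒lookup≡false {x = x} {p} x∉p with lookup p x in eq
... | true = contradiction (lookup⇒[]= x p eq) x∉p
... | false = refl

x∈p─q⇒x∉q : ∀ {n} {x : Fin n} {p q : Subset n} → x ∈ p ─ q → x ∉ q
x∈p─q⇒x∉q {p = _ ∷ _} {q = _ ∷ _} (there x∈p─q) (there x∈q) = x∈p─q⇒x∉q x∈p─q x∈q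

x∈p∪⁅y⁆⁻ : ∀ {n} {x y : Fin n} {p : Subset n} → x ∈ p ∪ ⁅ y ⁆ → x ∈ p ⊎ x ≡ y
x∈p∪⁅y⁆⁻ {y = y} {p} x∈ = [ inj₁ , inj₂ ∘ x∈⁅y⁆⇒x≡y y ] (x∈p∪q⁻ p ⁅ y ⁆ x∈)

∣p─q∪⁅x⁆∣<∣p─q∣ : ∀ {n} {x : Fin n} {p q : Subset n} → x ∈ p ─ q → ∣ p ─ (q ∪ ⁅ x ⁆) ∣ < ∣ p ─ q ∣
∣p─q∪⁅x⁆∣<∣p─q∣ {x = x} {p} {q} x∈p─q rewrite sym (p─q─r≡p─q∪r p q ⁅ x ⁆) = x∈p⇒∣p-x∣<∣p∣ x∈p─q

⊆⁅x⁆⇒∣p∣≤1 : ∀ {n} {x : Fin n} {p : Subset n} → p ⊆ ⁅ x ⁆ → ∣ p ∣ ≤ 1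
⊆⁅x⁆⇒∣p∣≤1 {x = x} p⊆⁅x⁆ rewrite sym (∣⁅x⁆∣≡1 x) = p⊆q⇒∣p∣≤∣q∣ p⊆⁅x⁆

Empty⇒∣p∣≡ᵇ0 : ∀ {n} {p : Subset n} → Empty p → (∣ p ∣ ≡ᵇ 0) ≡ true
Empty⇒∣p∣≡ᵇ0 {n} {p} empty = T-≡ .to (≡⇒≡ᵇ ∣ p ∣ 0 (trans (cong ∣_∣ (Empty-unique empty)) (∣⊥∣≡0 n)))

Nonempty⇒∣p∣≢ᵇ0 : ∀ {n} {p : Subset n} → Nonempty p → (∣ p ∣ ≡ᵇ 0) ≡ false
Nonempty⇒∣p∣≢ᵇ0 {p = p} (x , x∈p) with ∣ p ∣ | x∈p⇒∣p-x∣<∣p∣ x∈p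
... | suc _ | _ = refl

-- By definition i / suc m normalises fromℚᵘ (mkℚᵘ i m), so the comparison reduces to ℚᵘ.
/-monoˡ-≤ : ∀ {i j : ℤ} d .{{_ : NonZero d}} → i ≤ℤ j → i / d ≤ℚ j / d
/-monoˡ-≤ {i} {j} (suc m) i≤j = toℚᵘ-cancel-≤
  (≤-respˡ-≃ (≃-sym (toℚᵘ-fromℚᵘ (mkℚᵘ i m)))
  (≤-respʳ-≃ (≃-sym (toℚᵘ-fromℚᵘ (mkℚᵘ j m)))
    (*≤* (ℤ.*-monoʳ-≤-nonNeg (+ suc m) i≤j))))

fourThirds-mono : ∀ {a b} → a ≤ b → fourThirds a ≤ℚ fourThirds b
fourThirds-mono a≤b = /-monoˡ-≤ 3 (+≤+ (*-monoʳ-≤ 4 a≤b))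

module _ {n : ℕ} {E : Graph n} where

  path-start∈ : ∀ {R u v} → Path E R u v → u ∈ R
  path-start∈ (edge u∈R _ _) = u∈R
  path-start∈ (step p _ _) = path-start∈ p

  path-mono : ∀ {R R′ u v} → R ⊆ R′ → Path E R u v → Path E R′ u v
  path-mono R⊆R′ (edge u∈R v∈R e) = edge (R⊆R′ u∈R) (R⊆R′ v∈R) e
  path-mono R⊆R′ (step p e v∈R) = step (path-mono R⊆R′ p) e (R⊆R′ v∈R)

  path-trans : ∀ {R u w v} → Path E R u w → Path E R w v → Path E R u v
  path-trans p (edge _ v∈R e) = step p e v∈R
  path-trans p (step q e v∈R) = step (path-trans p q) e v∈R

module Ancestors {n : ℕ} (E : Graph n) (acyclic : Acyclic E)
                 (anc : Subset n → Fin n → Subset n)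
                 (anc-correct : ∀ R v → IsAncestorSet E R v (anc R v)) where

  ∈-anc⁻ : ∀ {R u v} → u ∈ anc R v → u ≡ v ⊎ Path E R u v
  ∈-anc⁻ {R} {u} {v} = anc-correct R v u .to

  v∈anc : ∀ {R v} → v ∈ anc R v
  v∈anc {R} {v} = anc-correct R v v .from (inj₁ refl)

  path⇒∈anc : ∀ {R u v} → Path E R u v → u ∈ anc R v
  path⇒∈anc {R} {u} {v} p = anc-correct R v u .from (inj₂ p)

  path-irrefl : ∀ {R v} → ¬ Path E R v v
  path-irrefl {v = v} p = acyclic v (path-mono (λ _ → ∈⊤) p)

  anc⊆ : ∀ {R v} → v ∈ R → anc R v ⊆ R
  anc⊆ v∈R u∈ancv with ∈-anc⁻ u∈ancv
  ... | inj₁ refl = v∈R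
  ... | inj₂ p = path-start∈ p

  anc-mono : ∀ {R R′ v} → R ⊆ R′ → anc R v ⊆ anc R′ v
  anc-mono R⊆R′ u∈ancv with ∈-anc⁻ u∈ancv
  ... | inj₁ refl = v∈anc
  ... | inj₂ p = path⇒∈anc (path-mono R⊆R′ p)

  path⇒anc⊆ : ∀ {R u v} → Path E R u v → anc R u ⊆ anc R v
  path⇒anc⊆ p w∈ancu with ∈-anc⁻ w∈ancu
  ... | inj₁ refl = path⇒∈anc p
  ... | inj₂ q = path⇒∈anc (path-trans q p)

  ∣anc∣-mono-< : ∀ {R u v} → Path E R u v → ∣ anc R u ∣ < ∣ anc R v ∣
  ∣anc∣-mono-< {R} {u} {v} p =
    p⊂q⇒∣p∣<∣q∣ (path⇒anc⊆ p , v , v∈anc , v∉ancu)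
    where
    v∉ancu : v ∉ anc R u
    v∉ancu v∈ancu with ∈-anc⁻ v∈ancu
    ... | inj₁ refl = path-irrefl p
    ... | inj₂ q = path-irrefl (path-trans p q)

  path-wellFounded : ∀ R → WellFounded (Path E R)
  path-wellFounded R = Subrelation.wellFounded ∣anc∣-mono-< (On.wellFounded (∣_∣ ∘ anc R) <-wellFounded)

  Minimal : Subset n → Subset n → Fin n → Set
  Minimal R X y = y ∈ X × (∀ {u} → u ∈ X → ¬ Path E R u y)

  minimal-below : ∀ {R X x} → Acc (Path E R) x → x ∈ X → ∃[ y ] Minimal R X y
  minimal-below {R} {X} {x} (acc rs) x∈X
    with any? (λ u → u ∈? X ×-dec u ∈? anc R x ×-dec ¬? (u ≟ x))
  ... | yes (u , u∈X , u∈ancx , u≢x) with ∈-anc⁻ u∈ancx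
  ...   | inj₁ u≡x = contradiction u≡x u≢x
  ...   | inj₂ p = minimal-below (rs p) u∈X
  minimal-below {x = x} _ x∈X | no ∄u =
    x , x∈X , λ u∈X p → ∄u (_ , u∈X , path⇒∈anc p , λ { refl → path-irrefl p })

  minimal-exists : ∀ {R X x} → x ∈ X → ∃[ y ] Minimal R X y
  minimal-exists {R} {x = x} = minimal-below (path-wellFounded R x)

  minimal-anc⊆⁅⁆ : ∀ {R X y S} → Minimal R X y → S ⊆ anc R y → S ⊆ X → S ⊆ ⁅ y ⁆
  minimal-anc⊆⁅⁆ (_ , minimal) S⊆anc S⊆X {u} u∈S with ∈-anc⁻ (S⊆anc u∈S)
  ... | inj₁ refl = x∈⁅x⁆ u
  ... | inj₂ p = contradiction p (minimal (S⊆X u∈S))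

  module QueueLoop (ρ : ℕ) (est : ℕ → Subset n → Fin n → ℚ) (k : ℕ) (R : Subset n) where
    open Algorithm E ρ est

    Accepted : Fin n → Set
    Accepted x = (est k R x ≤ℚᵇ fourThirds ρ) ≡ true

    PredsIn : Subset n → Fin n → Set
    PredsIn M x = ∀ {u} → u ∈ R → E u x ≡ true → u ∈ M

    PredsIn-mono : ∀ {M M′ x} → M ⊆ M′ → PredsIn M x → PredsIn M′ x
    PredsIn-mono M⊆M′ preds u∈R e = M⊆M′ (preds u∈R e)

    Closed : Subset n → Set
    Closed H = ∀ {x} → x ∈ R → Accepted x → PredsIn H x → x ∈ H

    ∈-sources⁻ : ∀ {x} → x ∈ₗ sources R → x ∈ R × PredsIn ∅ x
    ∈-sources⁻ {x} x∈ with T-∧ .to (proj₂ (∈-filter⁻ _ {xs = allFin n} x∈))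
    ... | x∈R , noPreds = lookup⇒[]= x R (T-≡ .to x∈R) , λ {u} u∈R e →
      contradiction e (not-∧⁻ (allB⁻ _ (allFin n) noPreds (∈-allFin u)) ([]=⇒lookup u∈R))

    ∈-sources⁺ : ∀ {x} → x ∈ R → PredsIn ∅ x → x ∈ₗ sources R
    ∈-sources⁺ {x} x∈R preds = ∈-filter⁺ _ (∈-allFin x) (T-∧ .from (T-≡ .from ([]=⇒lookup x∈R) ,
      allB⁺ _ (allFin n) λ {u} _ → not-∧⁺ λ u∈R e → ∉⊥ (preds (lookup⇒[]= u R u∈R) e)))

    ∈-readySuccs⁻ : ∀ {M v w} → w ∈ₗ readySuccs R M v → w ∈ R × E v w ≡ true × PredsIn M w
    ∈-readySuccs⁻ {M} {v} {w} w∈ with T-∧ .to (proj₂ (∈-filter⁻ _ {xs = allFin n} w∈))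
    ... | w∈R , rest with T-∧ .to rest
    ...   | e , ready = lookup⇒[]= w R (T-≡ .to w∈R) , T-≡ .to e , λ {u} u∈R e′ →
      lookup⇒[]= u M (not-∧-∨⁻ (allB⁻ _ (allFin n) ready (∈-allFin u)) ([]=⇒lookup u∈R) e′)

    ∈-readySuccs⁺ : ∀ {M v w} → w ∈ R → E v w ≡ true → PredsIn M w → w ∈ₗ readySuccs R M v
    ∈-readySuccs⁺ {M} {v} {w} w∈R e preds = ∈-filter⁺ _ (∈-allFin w)
      (T-∧ .from (T-≡ .from ([]=⇒lookup w∈R) , T-∧ .from (T-≡ .from e ,
        allB⁺ _ (allFin n) λ {u} _ → not-∧-∨⁺ λ u∈R e′ → []=⇒lookup (preds (lookup⇒[]= u R u∈R) e′))))

    -- D is the set of vertices dequeued so far and M ⊆ D the marked ones.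
    record QueueInv (D M : Subset n) (q : List (Fin n)) : Set where
      field
        distinct : Unique q
        queued : ∀ {x} → x ∈ₗ q → x ∈ R × x ∉ D × PredsIn M x
        marked⊆dequeued : M ⊆ D
        dequeued-ready : ∀ {x} → x ∈ D → PredsIn M x
        complete : ∀ {x} → x ∈ R → Accepted x → PredsIn M x → x ∈ M ⊎ x ∈ₗ q
    open QueueInv

    module _ {D M v q} (inv : QueueInv D M (v ∷ q)) where

      head∈R : v ∈ R
      head∈R = proj₁ (queued inv (here refl))

      head∉D : v ∉ D
      head∉D = proj₁ (proj₂ (queued inv (here refl)))

      dequeue-shrinks : ∣ R ─ (D ∪ ⁅ v ⁆) ∣ < ∣ R ─ D ∣
      dequeue-shrinks = ∣p─q∪⁅x⁆∣<∣p─q∣ (x∈p∧x∉q⇒x∈p─q head∈R head∉D)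

      tail-undequeued : ∀ {x} → x ∈ₗ q → x ∉ D ∪ ⁅ v ⁆
      tail-undequeued x∈q x∈D∪v with x∈p∪⁅y⁆⁻ x∈D∪v
      ... | inj₁ x∈D = proj₁ (proj₂ (queued inv (there x∈q))) x∈D
      ... | inj₂ refl = All.lookup (AllPairs.head (distinct inv)) x∈q refl

      dequeued∪head-ready : ∀ {M′ x} → M ⊆ M′ → x ∈ D ∪ ⁅ v ⁆ → PredsIn M′ x
      dequeued∪head-ready M⊆M′ x∈D∪v with x∈p∪⁅y⁆⁻ x∈D∪v
      ... | inj₁ x∈D = PredsIn-mono M⊆M′ (dequeued-ready inv x∈D)
      ... | inj₂ refl = PredsIn-mono M⊆M′ (proj₂ (proj₂ (queued inv (here refl))))

      -- A ready successor of v would force v ∈ M ⊆ D.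
      successor-unready : ∀ {w} → E v w ≡ true → ¬ PredsIn M w
      successor-unready e preds = head∉D (marked⊆dequeued inv (preds head∈R e))

      successor-undequeued : ∀ {w} → E v w ≡ true → w ∉ D ∪ ⁅ v ⁆
      successor-undequeued e w∈D∪v with x∈p∪⁅y⁆⁻ w∈D∪v
      ... | inj₁ w∈D = successor-unready e (dequeued-ready inv w∈D)
      ... | inj₂ refl = path-irrefl (edge head∈R head∈R e)

      reject-step : ¬ Accepted v → QueueInv (D ∪ ⁅ v ⁆) M q
      reject-step rejected = record
        { distinct = AllPairs.tail (distinct inv)
        ; queued = λ x∈q → let x∈R , _ , preds = queued inv (there x∈q)
                           in x∈R , tail-undequeued x∈q , preds
        ; marked⊆dequeued = p⊆p∪q _ ∘ marked⊆dequeued inv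
        ; dequeued-ready = dequeued∪head-ready id
        ; complete = λ x∈R accepted preds → drop-head accepted (complete inv x∈R accepted preds)
        }
        where
        drop-head : ∀ {x} → Accepted x → x ∈ M ⊎ x ∈ₗ v ∷ q → x ∈ M ⊎ x ∈ₗ q
        drop-head _ (inj₁ x∈M) = inj₁ x∈M
        drop-head accepted (inj₂ (here refl)) = contradiction accepted rejected
        drop-head _ (inj₂ (there x∈q)) = inj₂ x∈q

      preds-not-successor : ∀ {M′ x} → E v x ≡ false → PredsIn (M′ ∪ ⁅ v ⁆) x → PredsIn M′ x
      preds-not-successor {M′} e preds u∈R e′ with x∈p∪⁅y⁆⁻ {p = M′} (preds u∈R e′)
      ... | inj₁ u∈M′ = u∈M′
      ... | inj₂ refl = contradiction (trans (sym e′) e) λ ()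

      accept-step : QueueInv (D ∪ ⁅ v ⁆) (M ∪ ⁅ v ⁆) (q ++ readySuccs R (M ∪ ⁅ v ⁆) v)
      accept-step = record
        { distinct = ++⁺ (AllPairs.tail (distinct inv)) (filter⁺ _ (allFin⁺ n))
            λ (w∈q , w∈rs) → successor-unready (proj₁ (proj₂ (∈-readySuccs⁻ {M ∪ ⁅ v ⁆} w∈rs)))
                                               (proj₂ (proj₂ (queued inv (there w∈q))))
        ; queued = [ queued-tail , queued-succ ] ∘ ∈-++⁻ q
        ; marked⊆dequeued = λ x∈M∪v → [ p⊆p∪q _ ∘ marked⊆dequeued inv , q⊆p∪q D _ ] (x∈p∪q⁻ M _ x∈M∪v)
        ; dequeued-ready = dequeued∪head-ready (p⊆p∪q _)
        ; complete = complete-after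
        }
        where
        queued-tail : ∀ {x} → x ∈ₗ q → x ∈ R × x ∉ D ∪ ⁅ v ⁆ × PredsIn (M ∪ ⁅ v ⁆) x
        queued-tail x∈q = let x∈R , _ , preds = queued inv (there x∈q) in
          x∈R , tail-undequeued x∈q , PredsIn-mono (p⊆p∪q _) preds

        queued-succ : ∀ {x} → x ∈ₗ readySuccs R (M ∪ ⁅ v ⁆) v →
                      x ∈ R × x ∉ D ∪ ⁅ v ⁆ × PredsIn (M ∪ ⁅ v ⁆) x
        queued-succ x∈rs = let x∈R , e , preds = ∈-readySuccs⁻ x∈rs in
          x∈R , successor-undequeued e , preds

        requeue : ∀ {x} → x ∈ M ⊎ x ∈ₗ v ∷ q → x ∈ M ∪ ⁅ v ⁆ ⊎ x ∈ₗ q ++ readySuccs R (M ∪ ⁅ v ⁆) v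
        requeue (inj₁ x∈M) = inj₁ (p⊆p∪q _ x∈M)
        requeue (inj₂ (here refl)) = inj₁ (q⊆p∪q M _ (x∈⁅x⁆ v))
        requeue (inj₂ (there x∈q)) = inj₂ (∈-++⁺ˡ x∈q)

        complete-after : ∀ {x} → x ∈ R → Accepted x → PredsIn (M ∪ ⁅ v ⁆) x →
                    x ∈ M ∪ ⁅ v ⁆ ⊎ x ∈ₗ q ++ readySuccs R (M ∪ ⁅ v ⁆) v
        complete-after {x} x∈R accepted preds with E v x in e
        ... | true = inj₂ (∈-++⁺ʳ q (∈-readySuccs⁺ x∈R e preds))
        ... | false = requeue (complete inv x∈R accepted (preds-not-successor e preds))

    initial-inv : QueueInv ∅ ∅ (sources R)
    initial-inv = record
      { distinct = filter⁺ _ (allFin⁺ n)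
      ; queued = λ x∈ → let x∈R , preds = ∈-sources⁻ x∈ in x∈R , ∉⊥ , preds
      ; marked⊆dequeued = id
      ; dequeued-ready = ⊥-elim ∘ ∉⊥
      ; complete = λ x∈R _ preds → inj₂ (∈-sources⁺ x∈R preds)
      }

    -- Every step dequeues a vertex of R never dequeued before.
    loop-closed : ∀ f {D M q} → ∣ R ─ D ∣ ≤ f → QueueInv D M q →
                  ∃[ H ] queueLoop k R f q M ≡ just H × Closed H
    loop-closed _ {q = []} _ inv =
      _ , refl , λ x∈R accepted preds → [ id , (λ ()) ] (complete inv x∈R accepted preds)
    loop-closed zero {q = _ ∷ _} bound inv = contradiction (<-≤-trans (dequeue-shrinks inv) bound) n≮0
    loop-closed (suc f) {q = v ∷ _} bound inv with est k R v ≤ℚᵇ fourThirds ρ in decision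
    ... | true = loop-closed f (≤-pred (<-≤-trans (dequeue-shrinks inv) bound)) (accept-step inv)
    ... | false = loop-closed f (≤-pred (<-≤-trans (dequeue-shrinks inv) bound))
                    (reject-step inv λ accepted → contradiction (trans (sym decision) accepted) λ ())

    round-closed : ∃[ H ] queueLoop k R (suc n * suc n) (sources R) ∅ ≡ just H × Closed H
    round-closed = loop-closed (suc n * suc n) bound initial-inv
      where
      bound : ∣ R ─ ∅ ∣ ≤ suc n * suc n
      bound rewrite p─⊥≡p R = ≤-trans (∣p∣≤n R) (≤-trans (n≤1+n n) (m≤m*n (suc n) (suc n)))

    small⇒∈ : GoodEstimator E est → ∀ {H x} → Closed H → Acc (Path E R) x →
              x ∈ R → ∣ anc R x ∣ ≤ ρ → x ∈ H
    small⇒∈ good {H} {x} closed (acc rs) x∈R small = closed x∈R accepted preds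
      where
      accepted : Accepted x
      accepted = T-≡ .to (≤ℚ⇒≤ℚᵇ (≤ℚ-trans (proj₂ (good k R x (anc R x) x∈R (anc-correct R x)))
                                          (fourThirds-mono small)))
      preds : PredsIn H x
      preds {u} u∈R e = small⇒∈ good closed (rs u→x) u∈R (≤-trans (<⇒≤ (∣anc∣-mono-< u→x)) small)
        where
        u→x : Path E R u x
        u→x = edge u∈R x∈R e

module _ {n : ℕ} {E : Graph n} {ρ : ℕ} {est : ℕ → Subset n → Fin n → ℚ} where
  open Algorithm E ρ est

  rounds-∅ : ∀ {f k} R → (∣ R ∣ ≡ᵇ 0) ≡ true → rounds f k R ≡ just []
  rounds-∅ _ R≡∅ rewrite R≡∅ = refl

  rounds-step : ∀ {f k R H hs} → (∣ R ∣ ≡ᵇ 0) ≡ false →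
                queueLoop k R (suc n * suc n) (sources R) ∅ ≡ just H →
                rounds f (suc k) (R ─ H) ≡ just hs →
                rounds (suc f) k R ≡ just (H ∷ hs)
  rounds-step R≢∅ loop≡H rounds≡hs rewrite R≢∅ | loop≡H | rounds≡hs = refl

module _ {n : ℕ} (A : Fin n → Subset n) (ρ : ℕ) {W : Subset n} {x : Fin n} where

  ∈-nextLayer⁻ : x ∈ nextLayer A ρ W → ∣ A x ─ W ∣ ≤ ρ
  ∈-nextLayer⁻ x∈ = ≤ᵇ⇒≤ _ ρ (proj₂ (T-∧ {not (lookup W x)} .to (T-≡ .from
    (trans (sym (lookup∘tabulate _ x)) ([]=⇒lookup x∈)))))

  ∈-nextLayer⁺ : x ∉ W → ∣ A x ─ W ∣ ≤ ρ → x ∈ nextLayer A ρ W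
  ∈-nextLayer⁺ x∉W small = lookup⇒[]= x _ (trans (lookup∘tabulate _ x)
    (T-≡ .to (T-∧ .from (T-not-≡ .from (∉⇒lookup≡false x∉W) , ≤⇒≤ᵇ small))))

module Rounds {n : ℕ} (E : Graph n) (acyclic : Acyclic E)
              (anc : Subset n → Fin n → Subset n)
              (anc-correct : ∀ R v → IsAncestorSet E R v (anc R v))
              (ρ : ℕ) (1≤ρ : 1 ≤ ρ) (est : ℕ → Subset n → Fin n → ℚ) (good : GoodEstimator E est)
              (L : ℕ) (empty-beyond-L : ∀ j → L < j → Empty (layer (anc ⊤) ρ j)) where
  open Ancestors E acyclic anc anc-correct
    using (Minimal; minimal-exists; minimal-anc⊆⁅⁆; anc⊆; anc-mono; path-wellFounded; module QueueLoop)
  open Algorithm E ρ est using (rounds)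

  U : ℕ → Subset n
  U = unionUpTo (anc ⊤) ρ

  Avoids : Subset n → ℕ → Set
  Avoids R i = ∀ {x} → x ∈ R → x ∉ U i

  minimal-outside-U∈next-layer : ∀ {y} → Minimal ⊤ (∁ (U L)) y → y ∈ layer (anc ⊤) ρ (suc L)
  minimal-outside-U∈next-layer {y} y-minimal =
    ∈-nextLayer⁺ (anc ⊤) ρ (x∈∁p⇒x∉p (proj₁ y-minimal)) (≤-trans (⊆⁅x⁆⇒∣p∣≤1 new⊆⁅y⁆) 1≤ρ)
    where
    new⊆⁅y⁆ : anc ⊤ y ─ U L ⊆ ⁅ y ⁆
    new⊆⁅y⁆ = minimal-anc⊆⁅⁆ y-minimal (p─q⊆p (anc ⊤ y) (U L)) (x∉p⇒x∈∁p ∘ x∈p─q⇒x∉q {p = anc ⊤ y})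

  U-covers : ∀ x → x ∈ U L
  U-covers x = decidable-stable (x ∈? U L) λ x∉U →
    let y , y-minimal = minimal-exists (x∉p⇒x∈∁p x∉U)
    in empty-beyond-L (suc L) ≤-refl (y , minimal-outside-U∈next-layer y-minimal)

  anc⊆new-ancestors : ∀ {R i x} → Avoids R i → x ∈ R → anc R x ⊆ anc ⊤ x ─ U i
  anc⊆new-ancestors avoids x∈R u∈ancx =
    x∈p∧x∉q⇒x∈p─q (anc-mono (λ _ → ∈⊤) u∈ancx) (avoids (anc⊆ x∈R u∈ancx))

  next-layer-small : ∀ {R i x} → Avoids R i → x ∈ R → x ∈ layer (anc ⊤) ρ (suc i) → ∣ anc R x ∣ ≤ ρ
  next-layer-small {i = i} avoids x∈R x∈layer =
    ≤-trans (p⊆q⇒∣p∣≤∣q∣ (anc⊆new-ancestors {i = i} avoids x∈R)) (∈-nextLayer⁻ (anc ⊤) ρ x∈layer)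

  source-small : ∀ {R} → Nonempty R → ∃[ s ] s ∈ R × ∣ anc R s ∣ ≤ ρ
  source-small {R} (x , x∈R) =
    let s , s∈R , minimal = minimal-exists {R} {R} x∈R
        anc⊆⁅s⁆ : anc R s ⊆ ⁅ s ⁆
        anc⊆⁅s⁆ = minimal-anc⊆⁅⁆ (s∈R , minimal) id (anc⊆ s∈R)
    in s , s∈R , ≤-trans (⊆⁅x⁆⇒∣p∣≤1 anc⊆⁅s⁆) 1≤ρ

  SmallIn : Subset n → Subset n → Set
  SmallIn R H = ∀ {x} → x ∈ R → ∣ anc R x ∣ ≤ ρ → x ∈ H

  round-avoids-next-layer : ∀ {R H i} → Avoids R i → SmallIn R H → Avoids (R ─ H) (suc i)
  round-avoids-next-layer {R} {H} {i} avoids small⊆H {x} x∈R─H x∈U =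
    [ avoids x∈R , x∉H ∘ small⊆H x∈R ∘ next-layer-small {i = i} avoids x∈R ] (x∈p∪q⁻ (U i) _ x∈U)
    where
    x∈R : x ∈ R
    x∈R = p─q⊆p R H x∈R─H
    x∉H : x ∉ H
    x∉H = x∈p─q⇒x∉q x∈R─H

  round-shrinks : ∀ {R H} → Nonempty R → SmallIn R H → ∣ R ─ H ∣ < ∣ R ∣
  round-shrinks {R} {H} R≠∅ small⊆H =
    let s , s∈R , small = source-small R≠∅
    in p⊂q⇒∣p∣<∣q∣ (p─q⊆p R H , s , s∈R , λ s∈R─H → x∈p─q⇒x∉q s∈R─H (small⊆H s∈R small))

  closed⇒SmallIn : ∀ {k R H} → QueueLoop.Closed ρ est k R H → SmallIn R H
  closed⇒SmallIn {k} {R} closed = QueueLoop.small⇒∈ ρ est k R good closed (path-wellFounded R _)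

  avoids⇒<L : ∀ {R i} → Avoids R i → i ≤ L → Nonempty R → i < L
  avoids⇒<L avoids i≤L (x , x∈R) = ≤∧≢⇒< i≤L λ { refl → avoids x∈R (U-covers x) }

  rounds-length : ∀ f k R i → Avoids R i → i ≤ L → ∣ R ∣ < f →
                  ∃[ hs ] rounds f k R ≡ just hs × i + length hs ≤ L
  rounds-length zero _ _ _ _ _ ()
  rounds-length (suc f) k R i avoids i≤L size<f with nonempty? R
  ... | no R-empty = [] , rounds-∅ R (Empty⇒∣p∣≡ᵇ0 R-empty) , subst (_≤ L) (sym (+-identityʳ i)) i≤L
  ... | yes R≠∅ =
    let H , loop≡H , closed = QueueLoop.round-closed ρ est k R
        small⊆H = closed⇒SmallIn closed
        hs , rounds≡hs , bound = rounds-length f (suc k) (R ─ H) (suc i)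
          (round-avoids-next-layer {i = i} avoids small⊆H) (avoids⇒<L avoids i≤L R≠∅)
          (<-≤-trans (round-shrinks R≠∅ small⊆H) (≤-pred size<f))
    in H ∷ hs , rounds-step {E = E} (Nonempty⇒∣p∣≢ᵇ0 R≠∅) loop≡H rounds≡hs
              , subst (_≤ L) (sym (+-suc i (length hs))) bound

lemma21 : {n : ℕ} (E : Graph n) → Acyclic E →
          (ρ : ℕ) → 1 < ρ →
          (anc : Subset n → Fin n → Subset n) →
          (∀ R v → IsAncestorSet E R v (anc R v)) →
          (est : ℕ → Subset n → Fin n → ℚ) → GoodEstimator E est →
          (L : ℕ) → Nonempty (layer (anc ⊤) ρ L) →
          (∀ j → L < j → Empty (layer (anc ⊤) ρ j)) →
          ∃[ hs ] (Algorithm.scheduleGeneralGraph E ρ est ≡ just hs × length hs ≤ L)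
lemma21 {n} E acyclic ρ 1<ρ anc anc-correct est good L _ empty-beyond-L =
  rounds-length (suc n) zero ⊤ zero (λ _ → ∉⊥) z≤n (s≤s (≤-reflexive (∣⊤∣≡n n)))
  where open Rounds E acyclic anc anc-correct ρ (<⇒≤ 1<ρ) est good L empty-beyond-L
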